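{- Let $g(a,b)=1/a+1/b$. For a positive integer $p$, let $g_p$ denote the minimum value of $g(a,b)$ over integers $a,b$ with $1\le a\le b\le p$ and $ab\le p$, and let $n=\lfloor\sqrt{p}\rfloor$. Then $$ \begin{cases} g_p=\frac{2}{n}&\text{if }p\in[n^2,\,n^2+\lfloor n/2\rfloor],\\[.3em] g_p\ge\frac{2n+1}{p}&\text{if }p\in(n^2+\lfloor n/2\rfloor,\,n^2+2\lfloor n/2\rfloor],\\[.3em] g_p=\frac{2n+1}{n(n+1)}&\text{if }p\in(n^2+2\lfloor n/2\rfloor,\,n^2+n+\lfloor n/2\rfloor],\\[.3em] g_p\ge\frac{2n+2}{p}&\text{if }p\in(n^2+n+\lfloor n/2\rfloor,\,n^2+2n]. \end{cases} $$ -}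

module Defs where

open import Data.Nat as ℕ using (ℕ; zero; suc; _*_; _≤_)
open import Data.Integer using (+_)
open import Data.Rational as ℚ using (ℚ; _/_)
open import Data.Product using (_×_; ∃₂)

-- frac a d = a / d as a rational; d is always ≥ 1 where used
-- (the d = 0 case is a harmless junk value 0).
frac : ℕ → ℕ → ℚ
frac a zero    = ℚ.0ℚ
frac a (suc d) = (+ a) / suc d

g : ℕ → ℕ → ℚ
g a b = frac 1 a ℚ.+ frac 1 b

Admissible : ℕ → ℕ → ℕ → Set
Admissible p a b = 1 ≤ a × a ≤ b × b ≤ p × a * b ≤ p

IsMinG : ℕ → ℚ → Set
IsMinG p q =
  (∃₂ λ a b → Admissible p a b × g a b ≡ q) ×
  (∀ a b → Admissible p a b → q ℚ.≤ g a b)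
  where open import Relation.Binary.PropositionalEquality using (_≡_)

module Submission where

-- Write s = a + b, so that g(a,b) = s / ab.  An admissible pair falls into one
-- of three regimes, according to how s compares with 2n:
--   * s ≤ 2n      : by AM-GM, 4ab ≤ s² ≤ 2ns, hence g(a,b) ≥ 2/n;
--   * s = 2n + 1  : by AM-GM, 4ab ≤ (2n+1)² forces ab ≤ n(n+1), hence
--                   g(a,b) ≥ (2n+1)/(n(n+1)); also g(a,b) ≥ s/p = (2n+1)/p;
--   * s ≥ 2n + 2  : since ab ≤ p, g(a,b) ≥ s/p ≥ (2n+2)/p.
-- In each of the four ranges of p the claimed value is below all three regime
-- bounds; this comparison of candidate values reduces, by cross-multiplication,
-- to polynomial inequalities in n and ⌊n/2⌋, checked separately for n even and
-- n odd.  In the first and third range the bound is attained at (n, n),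
-- resp. (n, n+1), so it is the minimum.

open import Defs
open import Data.Nat using (ℕ; suc; _+_; _*_; _≤_; _<_; _/_)
open import Data.Rational as ℚ using (ℚ)
open import Data.Product using (Σ; _×_)
open import Relation.Binary.PropositionalEquality using (_≡_)

open import Data.Nat using (zero; NonZero; z≤n; s≤s; _≤?_; _%_; _∸_; >-nonZero⁻¹)
import Data.Nat.Properties as ℕₚ
open import Data.Nat.DivMod using (m%n<n; m≡m%n+[m/n]*n)
open import Data.Nat.Tactic.RingSolver using (solve)
open import Data.Integer as ℤ using (+_)
import Data.Integer.Properties as ℤₚ
import Data.Rational.Properties as ℚₚ
open import Data.Rational.Unnormalised as ℚᵘ using (mkℚᵘ)
import Data.Rational.Unnormalised.Properties as ℚᵘₚ
open import Data.List using (List; _∷_; []; filter; cartesianProduct; upTo)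
open import Data.List.Membership.Propositional using (_∈_)
open import Data.List.Membership.Propositional.Properties
  using (∈-filter⁺; ∈-cartesianProduct⁺; ∈-upTo⁺)
import Data.List.Relation.Unary.All as All
open import Data.List.Relation.Unary.All.Properties using (all-filter)
open import Relation.Binary using (DecTotalOrder; tri<; tri≈; tri>)
open import Data.List.Extrema (DecTotalOrder.totalOrder ℚₚ.≤-decTotalOrder) using (argmin; argmin-all; f[argmin]≤f[xs])
open import Data.Product using (_,_; proj₁; proj₂; uncurry)
open import Data.Sum using (_⊎_; inj₁; inj₂)
open import Relation.Unary using (Decidable)
open import Relation.Nullary.Decidable using (_×-dec_)
open import Relation.Binary.PropositionalEquality
  using (refl; sym; trans; cong; subst; subst₂)

≤-by : ∀ {x y} k → x + k ≡ y → x ≤ y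
≤-by {x} k eq = ℕₚ.m+n≤o⇒m≤o x (ℕₚ.≤-reflexive eq)

toℚᵘ-frac : ∀ x d → ℚ.toℚᵘ (frac x (suc d)) ℚᵘ.≃ mkℚᵘ (+ x) d
toℚᵘ-frac x d = ℚₚ.toℚᵘ-fromℚᵘ (mkℚᵘ (+ x) d)

frac-≤ : ∀ {x y} d e .{{_ : NonZero d}} .{{_ : NonZero e}} →
         x * e ≤ y * d → frac x d ℚ.≤ frac y e
frac-≤ {x} {y} (suc d) (suc e) xe≤yd =
  ℚₚ.toℚᵘ-cancel-≤
    (ℚᵘₚ.≤-respˡ-≃ (ℚᵘₚ.≃-sym (toℚᵘ-frac x d))
      (ℚᵘₚ.≤-respʳ-≃ (ℚᵘₚ.≃-sym (toℚᵘ-frac y e))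
        (ℚᵘ.*≤* (subst₂ ℤ._≤_ (ℤₚ.pos-* x (suc e)) (ℤₚ.pos-* y (suc d)) (ℤ.+≤+ xe≤yd)))))

frac-≡ : ∀ {x y} d e .{{_ : NonZero d}} .{{_ : NonZero e}} →
         x * e ≡ y * d → frac x d ≡ frac y e
frac-≡ d e xe≡yd =
  ℚₚ.≤-antisym (frac-≤ d e (ℕₚ.≤-reflexive xe≡yd)) (frac-≤ e d (ℕₚ.≤-reflexive (sym xe≡yd)))

g≡frac : ∀ a b .{{_ : NonZero a}} .{{_ : NonZero b}} → g a b ≡ frac (a + b) (a * b)
g≡frac (suc a) (suc b) = ℚₚ.toℚᵘ-injective (begin
    ℚ.toℚᵘ (frac 1 (suc a) ℚ.+ frac 1 (suc b))     ≈⟨ ℚₚ.toℚᵘ-homo-+ (frac 1 (suc a)) (frac 1 (suc b)) ⟩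
    ℚ.toℚᵘ (frac 1 (suc a)) ℚᵘ.+ ℚ.toℚᵘ (frac 1 (suc b))
                                                    ≈⟨ ℚᵘₚ.+-cong (toℚᵘ-frac 1 a) (toℚᵘ-frac 1 b) ⟩
    mkℚᵘ (+ 1) a ℚᵘ.+ mkℚᵘ (+ 1) b                 ≈⟨ ℚᵘ.*≡* (cong +_ (solve (a ∷ b ∷ []))) ⟩
    mkℚᵘ (+ (suc a + suc b)) (b + a * suc b)       ≈⟨ toℚᵘ-frac (suc a + suc b) (b + a * suc b) ⟨
    ℚ.toℚᵘ (frac (suc a + suc b) (suc a * suc b))  ∎)
  where open ℚᵘₚ.≃-Reasoning

frac≤g : ∀ {x} d a b .{{_ : NonZero d}} .{{_ : NonZero a}} .{{_ : NonZero b}} →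
         x * (a * b) ≤ (a + b) * d → frac x d ℚ.≤ g a b
frac≤g d a b bound =
  subst (frac _ d ℚ.≤_) (sym (g≡frac a b)) (frac-≤ d (a * b) bound)
  where instance ab≢0 = ℕₚ.m*n≢0 a b

frac≤g-by-product : ∀ {x d} a b .{{_ : NonZero d}} .{{_ : NonZero a}} .{{_ : NonZero b}} →
                    x ≤ a + b → a * b ≤ d → frac x d ℚ.≤ g a b
frac≤g-by-product {d = d} a b x≤s ab≤d = frac≤g d a b (ℕₚ.*-mono-≤ x≤s ab≤d)

-- 4ab ≤ (a + b)² when a ≤ b: write b = a + t, then (a + b)² = 4ab + t².
am-gm-ordered : ∀ {a b} → a ≤ b → 4 * (a * b) ≤ (a + b) * (a + b)
am-gm-ordered {a} {b} a≤b with b ∸ a | ℕₚ.m+[n∸m]≡n a≤b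
... | t | refl = ≤-by (t * t) (solve (a ∷ t ∷ []))

am-gm : ∀ a b → 4 * (a * b) ≤ (a + b) * (a + b)
am-gm a b with ℕₚ.≤-total a b
... | inj₁ a≤b = am-gm-ordered a≤b
... | inj₂ b≤a =
  subst₂ (λ u v → 4 * u ≤ v * v) (ℕₚ.*-comm b a) (ℕₚ.+-comm b a) (am-gm-ordered b≤a)

sum≤2n : ∀ a b n → a + b ≤ 2 * n → 2 * (a * b) ≤ (a + b) * n
sum≤2n a b n s≤2n = ℕₚ.*-cancelˡ-≤ 2 (begin
  2 * (2 * (a * b))    ≡⟨ solve (a ∷ b ∷ []) ⟩
  4 * (a * b)          ≤⟨ am-gm a b ⟩
  (a + b) * (a + b)    ≤⟨ ℕₚ.*-monoʳ-≤ (a + b) s≤2n ⟩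
  (a + b) * (2 * n)    ≡⟨ solve (a ∷ b ∷ n ∷ []) ⟩
  2 * ((a + b) * n)    ∎)
  where open ℕₚ.≤-Reasoning

-- If a + b = 2n + 1 then ab ≤ n(n + 1): AM-GM gives 4ab ≤ 4n(n + 1) + 1.
sum≡2n+1 : ∀ a b n → a + b ≡ 2 * n + 1 → a * b ≤ n * (n + 1)
sum≡2n+1 a b n s≡2n+1 =
  ℕₚ.m<1+n⇒m≤n (ℕₚ.*-cancelˡ-< 4 (a * b) (suc (n * (n + 1))) (begin-strict
    4 * (a * b)                 ≤⟨ am-gm a b ⟩
    (a + b) * (a + b)           ≡⟨ cong (λ s → s * s) s≡2n+1 ⟩
    (2 * n + 1) * (2 * n + 1)   ≡⟨ solve (n ∷ []) ⟩
    4 * (n * (n + 1)) + 1       <⟨ ℕₚ.+-monoʳ-< (4 * (n * (n + 1))) (s≤s (s≤s z≤n)) ⟩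
    4 * (n * (n + 1)) + 4       ≡⟨ solve (n ∷ []) ⟩
    4 * suc (n * (n + 1))       ∎))
  where open ℕₚ.≤-Reasoning

compare-2n : ∀ s n → s ≤ 2 * n ⊎ s ≡ 2 * n + 1 ⊎ 2 * n + 2 ≤ s
compare-2n s n with ℕₚ.<-cmp s (2 * n + 1)
... | tri< s<2n+1 _ _ = inj₁ (ℕₚ.m<1+n⇒m≤n (subst (s <_) (ℕₚ.+-comm (2 * n) 1) s<2n+1))
... | tri≈ _ s≡2n+1 _ = inj₂ (inj₁ s≡2n+1)
... | tri> _ _ 2n+1<s = inj₂ (inj₂ (subst (_≤ s) (sym (ℕₚ.+-suc (2 * n) 1)) 2n+1<s))

Half : ℕ → ℕ → Set
Half n h = n ≡ 2 * h ⊎ n ≡ 2 * h + 1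

half : ∀ n → Half n (n / 2)
half n with n % 2 | m%n<n n 2 | m≡m%n+[m/n]*n n 2
... | 0           | _               | n≡ = inj₁ (trans n≡ (ℕₚ.*-comm (n / 2) 2))
... | 1           | _               | n≡ =
  inj₂ (trans n≡ (trans (ℕₚ.+-comm 1 _) (cong (_+ 1) (ℕₚ.*-comm (n / 2) 2))))
... | suc (suc _) | s≤s (s≤s ())    | _

-- The polynomial inequalities behind the comparisons of the candidate values
-- 2/n, (2n+1)/(n(n+1)), (2n+1)/p and (2n+2)/p at the ends of the four ranges,
-- with h = ⌊n/2⌋; each is checked for n = 2h and n = 2h + 1.
estimate₁ : ∀ n h → Half n h → 2 * (n * n + h) ≤ (2 * n + 1) * n
estimate₁ n h (inj₁ refl) = ≤-by 0 (solve (h ∷ []))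
estimate₁ n h (inj₂ refl) = ≤-by 1 (solve (h ∷ []))

estimate₂ : ∀ n h → Half n h → (2 * n + 1) * n ≤ 2 * suc (n * n + h)
estimate₂ n h (inj₁ refl) = ≤-by 2 (solve (h ∷ []))
estimate₂ n h (inj₂ refl) = ≤-by 1 (solve (h ∷ []))

estimate₃ : ∀ n h → Half n h → (2 * n + 1) * (n * n + n + h) ≤ (2 * n + 2) * (n * (n + 1))
estimate₃ n h (inj₁ refl) = ≤-by h (solve (h ∷ []))
estimate₃ n h (inj₂ refl) = ≤-by (3 * h + 2) (solve (h ∷ []))

estimate₄ : ∀ n h → Half n h → (2 * n + 2) * (n * (n + 1)) ≤ (2 * n + 1) * suc (n * n + n + h)
estimate₄ n h (inj₁ refl) = ≤-by (3 * h + 1) (solve (h ∷ []))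
estimate₄ n h (inj₂ refl) = ≤-by (h + 1) (solve (h ∷ []))

estimate₅ : ∀ n h → Half n h → n * (n + 1) ≤ suc (n * n + 2 * h)
estimate₅ n h (inj₁ refl) = ≤-by 1 (solve (h ∷ []))
estimate₅ n h (inj₂ refl) = ≤-by 0 (solve (h ∷ []))

LowerBound : ℕ → ℚ → Set
LowerBound p r = ∀ a b → Admissible p a b → r ℚ.≤ g a b

module Bounds (n p : ℕ) .{{_ : NonZero n}} .{{_ : NonZero p}} where

  private instance
    n+1≢0 : NonZero (n + 1)
    n+1≢0 = subst NonZero (ℕₚ.+-comm 1 n) _

    n[n+1]≢0 : NonZero (n * (n + 1))
    n[n+1]≢0 = ℕₚ.m*n≢0 n (n + 1)

  data Regime (a b : ℕ) : Set where
    -- a + b ≤ 2n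
    balanced : frac 2 n ℚ.≤ g a b → Regime a b
    -- a + b = 2n + 1
    odd      : frac (2 * n + 1) (n * (n + 1)) ℚ.≤ g a b →
               frac (2 * n + 1) p ℚ.≤ g a b → Regime a b
    -- a + b ≥ 2n + 2
    spread   : frac (2 * n + 2) p ℚ.≤ g a b → Regime a b

  regime : ∀ {a b} → Admissible p a b → Regime a b
  regime {a@(suc _)} {b@(suc _)} (s≤s z≤n , s≤s _ , _ , ab≤p) with compare-2n (a + b) n
  ... | inj₁ s≤2n = balanced (frac≤g n a b (sum≤2n a b n s≤2n))
  ... | inj₂ (inj₁ s≡2n+1) =
    odd (frac≤g (n * (n + 1)) a b
          (subst (λ s → (2 * n + 1) * (a * b) ≤ s * (n * (n + 1))) (sym s≡2n+1)
            (ℕₚ.*-monoʳ-≤ (2 * n + 1) (sum≡2n+1 a b n s≡2n+1))))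
        (frac≤g-by-product a b (ℕₚ.≤-reflexive (sym s≡2n+1)) ab≤p)
  ... | inj₂ (inj₂ 2n+2≤s) = spread (frac≤g-by-product a b 2n+2≤s ab≤p)

  [2n+1]/p≤[2n+2]/p : frac (2 * n + 1) p ℚ.≤ frac (2 * n + 2) p
  [2n+1]/p≤[2n+2]/p = frac-≤ p p (ℕₚ.*-monoˡ-≤ p (ℕₚ.+-monoʳ-≤ (2 * n) (s≤s z≤n)))

  2/n≤[2n+1]/p : p ≤ n * n + n / 2 → frac 2 n ℚ.≤ frac (2 * n + 1) p
  2/n≤[2n+1]/p p≤ = frac-≤ n p (ℕₚ.≤-trans (ℕₚ.*-monoʳ-≤ 2 p≤) (estimate₁ n (n / 2) (half n)))

  [2n+1]/p≤2/n : n * n + n / 2 < p → frac (2 * n + 1) p ℚ.≤ frac 2 n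
  [2n+1]/p≤2/n <p = frac-≤ p n (ℕₚ.≤-trans (estimate₂ n (n / 2) (half n)) (ℕₚ.*-monoʳ-≤ 2 <p))

  [2n+1]/[n[n+1]]≤2/n : frac (2 * n + 1) (n * (n + 1)) ℚ.≤ frac 2 n
  [2n+1]/[n[n+1]]≤2/n = frac-≤ (n * (n + 1)) n (≤-by n (solve (n ∷ [])))

  [2n+1]/[n[n+1]]≤[2n+2]/p : p ≤ n * n + n + n / 2 →
                             frac (2 * n + 1) (n * (n + 1)) ℚ.≤ frac (2 * n + 2) p
  [2n+1]/[n[n+1]]≤[2n+2]/p p≤ = frac-≤ (n * (n + 1)) p
    (ℕₚ.≤-trans (ℕₚ.*-monoʳ-≤ (2 * n + 1) p≤) (estimate₃ n (n / 2) (half n)))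

  [2n+2]/p≤2/n : n * n + n + n / 2 < p → frac (2 * n + 2) p ℚ.≤ frac 2 n
  [2n+2]/p≤2/n <p = frac-≤ p n (begin
    (2 * n + 2) * n           ≡⟨ solve (n ∷ []) ⟩
    2 * (n * n + n)           ≤⟨ ℕₚ.*-monoʳ-≤ 2 (ℕₚ.≤-trans (ℕₚ.m≤m+n (n * n + n) _) (ℕₚ.<⇒≤ <p)) ⟩
    2 * p                     ∎)
    where open ℕₚ.≤-Reasoning

  [2n+2]/p≤[2n+1]/[n[n+1]] : n * n + n + n / 2 < p →
                             frac (2 * n + 2) p ℚ.≤ frac (2 * n + 1) (n * (n + 1))
  [2n+2]/p≤[2n+1]/[n[n+1]] <p = frac-≤ p (n * (n + 1))
    (ℕₚ.≤-trans (estimate₄ n (n / 2) (half n)) (ℕₚ.*-monoʳ-≤ (2 * n + 1) <p))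

  bound₁ : p ≤ n * n + n / 2 → LowerBound p (frac 2 n)
  bound₁ p≤ a b adm with regime adm
  ... | balanced 2/n≤g   = 2/n≤g
  ... | odd _ [2n+1]/p≤g = ℚₚ.≤-trans (2/n≤[2n+1]/p p≤) [2n+1]/p≤g
  ... | spread [2n+2]/p≤g =
    ℚₚ.≤-trans (2/n≤[2n+1]/p p≤) (ℚₚ.≤-trans [2n+1]/p≤[2n+2]/p [2n+2]/p≤g)

  bound₂ : n * n + n / 2 < p → LowerBound p (frac (2 * n + 1) p)
  bound₂ <p a b adm with regime adm
  ... | balanced 2/n≤g    = ℚₚ.≤-trans ([2n+1]/p≤2/n <p) 2/n≤g
  ... | odd _ [2n+1]/p≤g  = [2n+1]/p≤g
  ... | spread [2n+2]/p≤g = ℚₚ.≤-trans [2n+1]/p≤[2n+2]/p [2n+2]/p≤g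

  bound₃ : p ≤ n * n + n + n / 2 → LowerBound p (frac (2 * n + 1) (n * (n + 1)))
  bound₃ p≤ a b adm with regime adm
  ... | balanced 2/n≤g           = ℚₚ.≤-trans [2n+1]/[n[n+1]]≤2/n 2/n≤g
  ... | odd [2n+1]/[n[n+1]]≤g _ = [2n+1]/[n[n+1]]≤g
  ... | spread [2n+2]/p≤g        = ℚₚ.≤-trans ([2n+1]/[n[n+1]]≤[2n+2]/p p≤) [2n+2]/p≤g

  bound₄ : n * n + n + n / 2 < p → LowerBound p (frac (2 * n + 2) p)
  bound₄ <p a b adm with regime adm
  ... | balanced 2/n≤g           = ℚₚ.≤-trans ([2n+2]/p≤2/n <p) 2/n≤g
  ... | odd [2n+1]/[n[n+1]]≤g _ = ℚₚ.≤-trans ([2n+2]/p≤[2n+1]/[n[n+1]] <p) [2n+1]/[n[n+1]]≤g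
  ... | spread [2n+2]/p≤g        = [2n+2]/p≤g

  g[n,n] : g n n ≡ frac 2 n
  g[n,n] = trans (g≡frac n n) (frac-≡ (n * n) n {{ℕₚ.m*n≢0 n n}} (solve (n ∷ [])))

  g[n,n+1] : g n (n + 1) ≡ frac (2 * n + 1) (n * (n + 1))
  g[n,n+1] = trans (g≡frac n (n + 1)) (cong (λ x → frac x (n * (n + 1))) (solve (n ∷ [])))

  diagonal : n * n ≤ p → Admissible p n n
  diagonal n²≤p = >-nonZero⁻¹ n , ℕₚ.≤-refl , ℕₚ.≤-trans (ℕₚ.m≤m*n n n) n²≤p , n²≤p

  near-diagonal : n * n + 2 * (n / 2) < p → Admissible p n (n + 1)
  near-diagonal <p =
    >-nonZero⁻¹ n , ℕₚ.m≤m+n n 1 , ℕₚ.≤-trans (ℕₚ.m≤n*m (n + 1) n) n[n+1]≤p , n[n+1]≤p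
    where
    n[n+1]≤p : n * (n + 1) ≤ p
    n[n+1]≤p = ℕₚ.≤-trans (estimate₅ n (n / 2) (half n)) <p

admissible? : ∀ p → Decidable (uncurry (Admissible p))
admissible? p (a , b) = (1 ≤? a) ×-dec (a ≤? b) ×-dec (b ≤? p) ×-dec (a * b ≤? p)

-- Both entries of an admissible pair of p lie in 0 … p.
candidates : ℕ → List (ℕ × ℕ)
candidates p = cartesianProduct (upTo (suc p)) (upTo (suc p))

admissiblePairs : ℕ → List (ℕ × ℕ)
admissiblePairs p = filter (admissible? p) (candidates p)

∈-admissiblePairs : ∀ {p a b} → Admissible p a b → (a , b) ∈ admissiblePairs p
∈-admissiblePairs {p} adm@(_ , a≤b , b≤p , _) =
  ∈-filter⁺ (admissible? p)
    (∈-cartesianProduct⁺ (∈-upTo⁺ (s≤s (ℕₚ.≤-trans a≤b b≤p))) (∈-upTo⁺ (s≤s b≤p))) adm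

-- For p ≥ 1 the pair (1, 1) is admissible, so the argmin of g over the list of
-- admissible pairs is an admissible pair at which g is minimal.
minimum : ∀ p → 1 ≤ p → Σ ℚ (IsMinG p)
minimum p 1≤p = uncurry g best , (proj₁ best , proj₂ best , best-admissible , refl) , best-minimal
  where
  best : ℕ × ℕ
  best = argmin (uncurry g) (1 , 1) (admissiblePairs p)

  best-admissible : Admissible p (proj₁ best) (proj₂ best)
  best-admissible = argmin-all (uncurry g) {P = uncurry (Admissible p)}
    (ℕₚ.≤-refl , ℕₚ.≤-refl , 1≤p , 1≤p) (all-filter (admissible? p) (candidates p))

  best-minimal : LowerBound p (uncurry g best)
  best-minimal a b adm =
    All.lookup (f[argmin]≤f[xs] {f = uncurry g} (1 , 1) (admissiblePairs p)) (∈-admissiblePairs adm)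

≤min : ∀ {p q r} → IsMinG p q → LowerBound p r → r ℚ.≤ q
≤min ((a , b , adm , gab≡q) , _) r-low = subst (_ ℚ.≤_) gab≡q (r-low a b adm)

min≡ : ∀ {p q r a b} → IsMinG p q → Admissible p a b → g a b ≡ r → LowerBound p r → q ≡ r
min≡ isMin@(_ , q-low) adm gab≡r r-low =
  ℚₚ.≤-antisym (subst (_ ℚ.≤_) gab≡r (q-low _ _ adm)) (≤min isMin r-low)

lemma12 : (p n : ℕ) → 1 ≤ p → n * n ≤ p → p < suc n * suc n →
    Σ ℚ λ gp → IsMinG p gp ×
      ((n * n ≤ p → p ≤ n * n + n / 2 → gp ≡ frac 2 n) ×
       (n * n + n / 2 < p → p ≤ n * n + 2 * (n / 2) → frac (2 * n + 1) p ℚ.≤ gp) ×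
       (n * n + 2 * (n / 2) < p → p ≤ n * n + n + n / 2 → gp ≡ frac (2 * n + 1) (n * (n + 1))) ×
       (n * n + n + n / 2 < p → p ≤ n * n + 2 * n → frac (2 * n + 2) p ℚ.≤ gp))
-- The bound p < (n + 1)² only serves to exclude n = 0, which would force p < 1.
lemma12 (suc _) zero (s≤s z≤n) _ (s≤s ())
lemma12 p@(suc _) n@(suc _) 1≤p n²≤p _ = gp , isMin , range₁ , range₂ , range₃ , range₄
  where
  open Bounds n p
  gp : ℚ
  gp = proj₁ (minimum p 1≤p)
  isMin : IsMinG p gp
  isMin = proj₂ (minimum p 1≤p)

  range₁ : n * n ≤ p → p ≤ n * n + n / 2 → gp ≡ frac 2 n
  range₁ _ p≤ = min≡ isMin (diagonal n²≤p) g[n,n] (bound₁ p≤)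

  range₂ : n * n + n / 2 < p → p ≤ n * n + 2 * (n / 2) → frac (2 * n + 1) p ℚ.≤ gp
  range₂ <p _ = ≤min isMin (bound₂ <p)

  range₃ : n * n + 2 * (n / 2) < p → p ≤ n * n + n + n / 2 → gp ≡ frac (2 * n + 1) (n * (n + 1))
  range₃ <p p≤ = min≡ isMin (near-diagonal <p) g[n,n+1] (bound₃ p≤)

  range₄ : n * n + n + n / 2 < p → p ≤ n * n + 2 * n → frac (2 * n + 2) p ℚ.≤ gp
  range₄ <p _ = ≤min isMin (bound₄ <p)
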